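{- Let $N=\{d_1,\ldots,d_m\}$ be a combinatorial $d$-manifold with $n$ vertices that is the union of $m$ difference cycles $d_i=(a_i^0:\ldots:a_i^d)$, $1\le i\le m$. Fix $l\in\mathbb{N}$ and non-negative integers $l_i^j$ ($1\le i\le m$, $0\le j\le d$) with $\sum_{j=0}^d l_i^j=l$ for each $i$. For $k\ge 0$, let $N_k=\{d_{1,k},\ldots,d_{m,k}\}$ be the simplicial complex on $n+lk$ vertices given by the difference cycles $d_{i,k}=(a_i^0+l_i^0k:\ldots:a_i^d+l_i^dk)$. Suppose that $$\frac{(l_i^j+1)n}{l+1}>a_i^j>\frac{l_i^j n}{l+1}$$ for all $1\le i\le m$ and $0\le j\le d$. Then $N_k$ is a combinatorial $d$-manifold for all $k\ge 0$.
   Context: For positive integers $a_0,\ldots,a_d$ with $N=\sum a_i$, the difference cycle $(a_0:\ldots:a_d)$ on $N$ vertices is the orbit of the simplex $\langle 0,a_0,a_0+a_1,\ldots,\sum_{i=0}^{d-1}a_i\rangle$ under $v\mapsto v+1\bmod N$ on $\mathbb{Z}_N$. A set of difference cycles denotes their union. A combinatorial $d$-manifold is a pure $d$-dimensional simplicial complex in which every vertex link is a triangulated $(d-1)$-sphere PL-homeomorphic to the boundary of the $d$-simplex. -}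

module Defs where

open import Data.Nat using (ℕ; zero; suc; _+_; _*_; _<_; _%_)
open import Data.Nat.Properties using (_≟_)
open import Data.Fin using (Fin; zero; suc)
open import Data.Bool using (Bool; true; _∧_; if_then_else_)
open import Data.List using (List; []; _∷_; [_]; map; filter; concatMap; upTo; allFin; length)
open import Data.List.Membership.Propositional using (_∈_)
open import Data.List.Membership.DecPropositional _≟_ using (_∈?_)
open import Data.List.Relation.Binary.Subset.Propositional using (_⊆_)
open import Data.List.Relation.Unary.Unique.Propositional using (Unique)
open import Data.Product using (Σ; ∃; _×_; _,_)
open import Data.Sum using (_⊎_)
open import Relation.Nullary using (¬_; ¬?; does)
open import Relation.Binary.PropositionalEquality using (_≡_; _≢_)
open import Relation.Binary.Construct.Closure.ReflexiveTransitive using (Star)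
open import Function using (_∘_)
open import Function.Definitions using (Injective)

-- A complex is represented by a finite list of generating simplices;
-- its faces are all vertex sets contained in some generator.

Simplex : Set
Simplex = List ℕ

Complex : Set
Complex = List Simplex

IsFace : Complex → Simplex → Set
IsFace K σ = ∃ λ τ → τ ∈ K × σ ⊆ τ

IsVertex : Complex → ℕ → Set
IsVertex K v = ∃ λ τ → τ ∈ K × v ∈ τ

_≈_ : Complex → Complex → Set
K ≈ L = ∀ σ → (IsFace K σ → IsFace L σ) × (IsFace L σ → IsFace K σ)

_∈ᵇ_ : ℕ → List ℕ → Bool
x ∈ᵇ τ = does (x ∈? τ)

_⊆ᵇ_ : List ℕ → List ℕ → Bool
[] ⊆ᵇ τ = true
(x ∷ A) ⊆ᵇ τ = (x ∈ᵇ τ) ∧ (A ⊆ᵇ τ)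

remove : ℕ → List ℕ → List ℕ
remove v = filter (λ x → ¬? (x ≟ v))

Pure : ℕ → Complex → Set
Pure d K = ∀ τ → τ ∈ K → Unique τ × length τ ≡ suc d

-- Link of a vertex v (for a complex given by its facets).
link : Complex → ℕ → Complex
link K v = map (remove v) (filter (λ τ → v ∈? τ) K)

bdSimplex : ℕ → Complex
bdSimplex d = map (λ i → remove i (upTo (suc d))) (upTo (suc d))

-- PL homeomorphism, combinatorially (Alexander–Newman): finite sequence
-- of stellar subdivisions, their inverses (welds) and simplicial
-- isomorphisms.

-- Stellar subdivision of K at the face A with new vertex a:
-- (K ∖ st A) ∪ a * ∂A * lk A.  A generator τ ⊇ A is replaced by the
-- simplices a ∪ (τ ∖ {x}) for x ∈ A.
subdivide : Complex → Simplex → ℕ → Complex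
subdivide K A a =
  concatMap (λ τ → if A ⊆ᵇ τ then map (λ x → a ∷ remove x τ) A else [ τ ]) K

StellarSub : Complex → Complex → Set
StellarSub K L = Σ Simplex λ A → Σ ℕ λ a →
  A ≢ [] × IsFace K A × ¬ IsVertex K a × L ≈ subdivide K A a

Iso : Complex → Complex → Set
Iso K L = Σ (ℕ → ℕ) λ f → Injective _≡_ _≡_ f × L ≈ map (map f) K

Move : Complex → Complex → Set
Move K L = StellarSub K L ⊎ StellarSub L K ⊎ Iso K L ⊎ Iso L K

PLHomeomorphic : Complex → Complex → Set
PLHomeomorphic = Star Move

IsCombManifold : ℕ → Complex → Set
IsCombManifold d K =
  Pure d K × (∀ v → IsVertex K v → PLHomeomorphic (link K v) (bdSimplex d))

ΣF : ∀ {n} → (Fin n → ℕ) → ℕ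
ΣF {zero} f = 0
ΣF {suc n} f = f zero + ΣF (f ∘ suc)

psums : ∀ {d} → (Fin (suc d) → ℕ) → List ℕ
psums {zero} a = 0 ∷ []
psums {suc d} a = 0 ∷ map (a zero +_) (psums (a ∘ suc))

modN : ℕ → ℕ → ℕ
modN x zero = x
modN x (suc n) = x % suc n

diffCycle : ∀ {d} → (Fin (suc d) → ℕ) → Complex
diffCycle a = map (λ v → map (λ x → modN (x + v) N) (psums a)) (upTo N)
  where N = ΣF a

diffCycles : ∀ {m d} → (Fin m → Fin (suc d) → ℕ) → Complex
diffCycles {m} a = concatMap (λ i → diffCycle (a i)) (allFin m)

{-# OPTIONS --safe #-}
module Submission where

-- Write A s, Λ s for the partial sums of a i, lij i and n′ = n + l k. The link of 0 in N has
-- the vertices (A s − A t) mod n, and the link of any vertex v of N_k the vertices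
-- v + (A s − A t + Λ s k − Λ t k) mod n′. Both correspond under y ↦ v + y + ⌊y (l+1) / n⌋ k:
-- the hypotheses make a j (l+1) = lij j n + r j with 0 < r j and Σ r = n, so
-- ⌊(A s − A t mod n)(l+1) / n⌋ is Λ s − Λ t for t < s and Λ s − Λ t + l for s < t.
-- Thus every vertex link of N_k is isomorphic to a vertex link of N, hence a PL sphere.

open import Defs
open import Data.Nat
open import Data.Nat.Properties
open import Data.Nat.DivMod
open import Data.Nat.Tactic.RingSolver using (solve-∀)
open import Algebra.Properties.CommutativeSemigroup +-commutativeSemigroup
  using (interchange; x∙yz≈y∙xz; xy∙z≈y∙xz; xy∙z≈xz∙y)
open import Data.Fin using (Fin; zero; suc; toℕ)
import Data.Fin.Properties as Fin
open import Data.List using (List; _∷_; map; tabulate; length; upTo; allFin)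
open import Data.List.Properties using (map-tabulate; length-tabulate)
open import Data.List.Membership.Propositional using (_∈_; find; lose)
open import Data.List.Membership.Propositional.Properties
open import Data.List.Membership.DecPropositional _≟_ using (_∈?_)
open import Data.List.Relation.Binary.Subset.Propositional using (_⊆_)
open import Data.List.Relation.Unary.Unique.Propositional using (Unique)
import Data.List.Relation.Unary.Unique.Propositional.Properties as Unique
open import Data.Product using (∃; _×_; _,_)
open import Data.Sum using (_⊎_; inj₁; inj₂)
open import Data.Empty using (⊥-elim)
open import Function using (_∘_)
open import Function.Definitions using (Injective)
open import Relation.Nullary using (¬?; yes; no)
open import Relation.Binary using (Rel; Trichotomous; tri<; tri≈; tri>)
open import Relation.Binary.PropositionalEquality
open import Relation.Binary.Construct.Closure.ReflexiveTransitive using (_◅_)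

strictMono⇒injective : ∀ {a ℓ} {A : Set a} {_≺_ : Rel A ℓ} → Trichotomous _≡_ _≺_ →
                       (f : A → ℕ) → (∀ {x y} → x ≺ y → f x < f y) → Injective _≡_ _≡_ f
strictMono⇒injective compare f mono {x} {y} fx≡fy with compare x y
... | tri< x≺y _ _ = ⊥-elim (<-irrefl fx≡fy (mono x≺y))
... | tri≈ _ x≡y _ = x≡y
... | tri> _ _ y≺x = ⊥-elim (<-irrefl (sym fx≡fy) (mono y≺x))

ΣF-cong : ∀ {d} {a b : Fin d → ℕ} → (∀ j → a j ≡ b j) → ΣF a ≡ ΣF b
ΣF-cong {zero}  a≡b = refl
ΣF-cong {suc d} a≡b = cong₂ _+_ (a≡b zero) (ΣF-cong (a≡b ∘ suc))

ΣF-+ : ∀ {d} (a b : Fin d → ℕ) → ΣF (λ j → a j + b j) ≡ ΣF a + ΣF b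
ΣF-+ {zero}  a b = refl
ΣF-+ {suc d} a b =
  trans (cong (a zero + b zero +_) (ΣF-+ (a ∘ suc) (b ∘ suc)))
        (interchange (a zero) (b zero) (ΣF (a ∘ suc)) (ΣF (b ∘ suc)))

ΣF-* : ∀ {d} (a : Fin d → ℕ) c → ΣF (λ j → a j * c) ≡ ΣF a * c
ΣF-* {zero}  a c = refl
ΣF-* {suc d} a c =
  trans (cong (a zero * c +_) (ΣF-* (a ∘ suc) c)) (sym (*-distribʳ-+ c (a zero) _))

prefixSum : ∀ {d} → (Fin (suc d) → ℕ) → Fin (suc d) → ℕ
prefixSum a zero = 0
prefixSum {suc d} a (suc s) = a zero + prefixSum (a ∘ suc) s

psums≡tabulate : ∀ {d} (a : Fin (suc d) → ℕ) → psums a ≡ tabulate (prefixSum a)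
psums≡tabulate {zero}  a = refl
psums≡tabulate {suc d} a = cong (0 ∷_) (begin
  map (a zero +_) (psums (a ∘ suc))                ≡⟨ cong (map (a zero +_)) (psums≡tabulate (a ∘ suc)) ⟩
  map (a zero +_) (tabulate (prefixSum (a ∘ suc))) ≡⟨ map-tabulate (prefixSum (a ∘ suc)) (a zero +_) ⟩
  tabulate (prefixSum a ∘ suc)                     ∎)
  where open ≡-Reasoning

map-psums : ∀ {d} (a : Fin (suc d) → ℕ) (h : ℕ → ℕ) → map h (psums a) ≡ tabulate (h ∘ prefixSum a)
map-psums a h = trans (cong (map h) (psums≡tabulate a)) (map-tabulate (prefixSum a) h)

∈-map-psums⁻ : ∀ {d} (a : Fin (suc d) → ℕ) (h : ℕ → ℕ) {x} →
               x ∈ map h (psums a) → ∃ λ s → x ≡ h (prefixSum a s)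
∈-map-psums⁻ a h x∈ = ∈-tabulate⁻ (subst (_ ∈_) (map-psums a h) x∈)

∈-map-psums⁺ : ∀ {d} (a : Fin (suc d) → ℕ) (h : ℕ → ℕ) s → h (prefixSum a s) ∈ map h (psums a)
∈-map-psums⁺ a h s = subst (h (prefixSum a s) ∈_) (sym (map-psums a h)) (∈-tabulate⁺ {f = h ∘ prefixSum a} s)

prefixSum-cong : ∀ {d} {a b : Fin (suc d) → ℕ} → (∀ j → a j ≡ b j) → ∀ s → prefixSum a s ≡ prefixSum b s
prefixSum-cong         a≡b zero    = refl
prefixSum-cong {suc d} a≡b (suc s) = cong₂ _+_ (a≡b zero) (prefixSum-cong (a≡b ∘ suc) s)

prefixSum-+ : ∀ {d} (a b : Fin (suc d) → ℕ) s →
              prefixSum (λ j → a j + b j) s ≡ prefixSum a s + prefixSum b s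
prefixSum-+         a b zero    = refl
prefixSum-+ {suc d} a b (suc s) =
  trans (cong (a zero + b zero +_) (prefixSum-+ (a ∘ suc) (b ∘ suc) s))
        (interchange (a zero) (b zero) (prefixSum (a ∘ suc) s) (prefixSum (b ∘ suc) s))

prefixSum-* : ∀ {d} (a : Fin (suc d) → ℕ) c s → prefixSum (λ j → a j * c) s ≡ prefixSum a s * c
prefixSum-*         a c zero    = refl
prefixSum-* {suc d} a c (suc s) =
  trans (cong (a zero * c +_) (prefixSum-* (a ∘ suc) c s)) (sym (*-distribʳ-+ c (a zero) _))

prefixSum<ΣF : ∀ {d} (a : Fin (suc d) → ℕ) → (∀ j → 0 < a j) → ∀ s → prefixSum a s < ΣF a
prefixSum<ΣF         a a>0 zero    = <-≤-trans (a>0 zero) (m≤m+n _ _)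
prefixSum<ΣF {suc d} a a>0 (suc s) = +-monoʳ-< (a zero) (prefixSum<ΣF (a ∘ suc) (a>0 ∘ suc) s)

prefixSum-strictMono : ∀ {d} (a : Fin (suc d) → ℕ) → (∀ j → 0 < a j) →
                       ∀ {s t} → toℕ s < toℕ t → prefixSum a s < prefixSum a t
prefixSum-strictMono {suc d} a a>0 {zero}  {suc t} _         = <-≤-trans (a>0 zero) (m≤m+n _ _)
prefixSum-strictMono {suc d} a a>0 {suc s} {suc t} (s≤s s<t) =
  +-monoʳ-< (a zero) (prefixSum-strictMono (a ∘ suc) (a>0 ∘ suc) s<t)

prefixSum-injective : ∀ {d} (a : Fin (suc d) → ℕ) → (∀ j → 0 < a j) → Injective _≡_ _≡_ (prefixSum a)
prefixSum-injective a a>0 = strictMono⇒injective Fin.<-cmp (prefixSum a) (prefixSum-strictMono a a>0)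

module _ {N : ℕ} .{{_ : NonZero N}} where

  divMod-unique : ∀ {q₁ r₁ q₂ r₂} → r₁ < N → r₂ < N →
                  q₁ * N + r₁ ≡ q₂ * N + r₂ → q₁ ≡ q₂ × r₁ ≡ r₂
  divMod-unique {q₁} {r₁} {q₂} {r₂} r₁<N r₂<N e =
    *-cancelʳ-≡ q₁ q₂ N (+-cancelʳ-≡ _ _ _ q₁N+r₂≡q₂N+r₂) , r₁≡r₂
    where
    remainder : ∀ q {r} → r < N → (q * N + r) % N ≡ r
    remainder q {r} r<N = trans (cong (_% N) (+-comm (q * N) r)) (trans ([m+kn]%n≡m%n r q N) (m<n⇒m%n≡m r<N))
    r₁≡r₂ : r₁ ≡ r₂
    r₁≡r₂ = trans (sym (remainder q₁ r₁<N)) (trans (cong (_% N) e) (remainder q₂ r₂<N))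
    q₁N+r₂≡q₂N+r₂ : q₁ * N + r₂ ≡ q₂ * N + r₂
    q₁N+r₂≡q₂N+r₂ = trans (cong (q₁ * N +_) (sym r₁≡r₂)) e

  carry-split : ∀ {q Q ρ r r′} → ρ < N → r < N → r′ < N → q * N + (ρ + r) ≡ Q * N + r′ →
                (q ≡ Q × r ≤ r′) ⊎ (suc q ≡ Q × r′ < r)
  carry-split {q} {Q} {ρ} {r} {r′} ρ<N r<N r′<N e with ρ + r <? N
  ... | yes ρ+r<N =
    let q≡Q , ρ+r≡r′ = divMod-unique ρ+r<N r′<N e in inj₁ (q≡Q , subst (r ≤_) ρ+r≡r′ (m≤n+m r ρ))
  ... | no ρ+r≮N =
    let suc-q≡Q , excess≡r′ = divMod-unique (<-trans excess<r r<N) r′<N carried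
    in  inj₂ (suc-q≡Q , subst (_< r) excess≡r′ excess<r)
    where
    N+excess : N + (ρ + r ∸ N) ≡ ρ + r
    N+excess = m+[n∸m]≡n (≮⇒≥ ρ+r≮N)
    excess<r : ρ + r ∸ N < r
    excess<r = +-cancelˡ-< N _ _ (subst (_< N + r) (sym N+excess) (+-monoˡ-< r ρ<N))
    carried : suc q * N + (ρ + r ∸ N) ≡ Q * N + r′
    carried = trans (xy∙z≈y∙xz N (q * N) _) (trans (cong (q * N +_) N+excess) e)

  [m%n+o]%n≡[m+o]%n : ∀ m o → (m % N + o) % N ≡ (m + o) % N
  [m%n+o]%n≡[m+o]%n m o = begin
    (m % N + o) % N         ≡⟨ %-distribˡ-+ (m % N) o N ⟩
    (m % N % N + o % N) % N ≡⟨ cong (λ x → (x + o % N) % N) (m%n%n≡m%n m N) ⟩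
    (m % N + o % N) % N     ≡⟨ sym (%-distribˡ-+ m o N) ⟩
    (m + o) % N             ∎
    where open ≡-Reasoning

  [m+o%n]%n≡[m+o]%n : ∀ m o → (m + o % N) % N ≡ (m + o) % N
  [m+o%n]%n≡[m+o]%n m o = begin
    (m + o % N) % N ≡⟨ cong (_% N) (+-comm m (o % N)) ⟩
    (o % N + m) % N ≡⟨ [m%n+o]%n≡[m+o]%n o m ⟩
    (o + m) % N     ≡⟨ cong (_% N) (+-comm o m) ⟩
    (m + o) % N     ∎
    where open ≡-Reasoning

  [m+[n∸m%n]]%n≡0 : ∀ m → (m + (N ∸ m % N)) % N ≡ 0
  [m+[n∸m%n]]%n≡0 m = begin
    (m + (N ∸ m % N)) % N     ≡⟨ sym ([m%n+o]%n≡[m+o]%n m _) ⟩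
    (m % N + (N ∸ m % N)) % N ≡⟨ cong (_% N) (m+[n∸m]≡n (m%n≤n m N)) ⟩
    N % N                     ≡⟨ n%n≡0 N ⟩
    0                         ∎
    where open ≡-Reasoning

  [m+[o+[n∸m%n]]%n]%n≡o%n : ∀ m o → (m + (o + (N ∸ m % N)) % N) % N ≡ o % N
  [m+[o+[n∸m%n]]%n]%n≡o%n m o = begin
    (m + (o + c) % N) % N ≡⟨ [m+o%n]%n≡[m+o]%n m (o + c) ⟩
    (m + (o + c)) % N     ≡⟨ cong (_% N) (x∙yz≈y∙xz m o c) ⟩
    (o + (m + c)) % N     ≡⟨ sym ([m+o%n]%n≡[m+o]%n o (m + c)) ⟩
    (o + (m + c) % N) % N ≡⟨ cong (λ x → (o + x) % N) ([m+[n∸m%n]]%n≡0 m) ⟩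
    (o + 0) % N           ≡⟨ cong (_% N) (+-identityʳ o) ⟩
    o % N                 ∎
    where open ≡-Reasoning
          c = N ∸ m % N

  +-%-cancelʳ : ∀ {p q} v → p < N → q < N → (p + v) % N ≡ (q + v) % N → p ≡ q
  +-%-cancelʳ {p} {q} v p<N q<N e =
    trans (sym (undo p<N)) (trans (cong (λ x → (x + (N ∸ v % N)) % N) e) (undo q<N))
    where
    open ≡-Reasoning
    undo : ∀ {x} → x < N → ((x + v) % N + (N ∸ v % N)) % N ≡ x
    undo {x} x<N = begin
      ((x + v) % N + (N ∸ v % N)) % N ≡⟨ [m%n+o]%n≡[m+o]%n (x + v) _ ⟩
      (x + v + (N ∸ v % N)) % N       ≡⟨ cong (_% N) (+-assoc x v _) ⟩
      (x + (v + (N ∸ v % N))) % N     ≡⟨ sym ([m+o%n]%n≡[m+o]%n x _) ⟩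
      (x + (v + (N ∸ v % N)) % N) % N ≡⟨ cong (λ z → (x + z) % N) ([m+[n∸m%n]]%n≡0 v) ⟩
      (x + 0) % N                     ≡⟨ cong (_% N) (+-identityʳ x) ⟩
      x % N                           ≡⟨ m<n⇒m%n≡m x<N ⟩
      x                               ∎

  m%n≡o⇒m≡o⊎m≡o+n : ∀ {m o} → m < N + N → m % N ≡ o → m ≡ o ⊎ m ≡ o + N
  m%n≡o⇒m≡o⊎m≡o+n {m} m<N+N m%N≡o with m <? N
  ... | yes m<N = inj₁ (trans (sym (m<n⇒m%n≡m m<N)) m%N≡o)
  ... | no  m≮N = inj₂ (trans (sym (m∸n+n≡m N≤m))
                         (cong (_+ N) (trans (sym (m<n⇒m%n≡m m∸N<N)) (trans (m≤n⇒[n∸m]%m≡n%m N≤m) m%N≡o))))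
    where
    N≤m : N ≤ m
    N≤m = ≮⇒≥ m≮N
    m∸N<N : m ∸ N < N
    m∸N<N = +-cancelˡ-< N _ _ (subst (_< N + N) (sym (m+[n∸m]≡n N≤m)) m<N+N)

  %-difference : ∀ {X Y} w → X < N → Y < N → (Y + w) % N ≡ 0 →
                 (X + w) % N + Y ≡ X ⊎ (X + w) % N + Y ≡ X + N
  %-difference {X} {Y} w X<N Y<N Yw≡0 = m%n≡o⇒m≡o⊎m≡o+n (+-mono-< (m%n<n (X + w) N) Y<N) (begin
    ((X + w) % N + Y) % N ≡⟨ [m%n+o]%n≡[m+o]%n (X + w) Y ⟩
    (X + w + Y) % N       ≡⟨ cong (_% N) (trans (+-assoc X w Y) (cong (X +_) (+-comm w Y))) ⟩
    (X + (Y + w)) % N     ≡⟨ sym ([m+o%n]%n≡[m+o]%n X (Y + w)) ⟩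
    (X + (Y + w) % N) % N ≡⟨ cong (λ z → (X + z) % N) Yw≡0 ⟩
    (X + 0) % N           ≡⟨ cong (_% N) (+-identityʳ X) ⟩
    X % N                 ≡⟨ m<n⇒m%n≡m X<N ⟩
    X                     ∎)
    where open ≡-Reasoning

  %-shift : ∀ {g x z} w → g + x ≡ z ⊎ g + x ≡ z + N → (g + (x + w) % N) % N ≡ (z + w) % N
  %-shift {g} {x} {z} w g+x≡z[+N] = begin
    (g + (x + w) % N) % N ≡⟨ [m+o%n]%n≡[m+o]%n g (x + w) ⟩
    (g + (x + w)) % N     ≡⟨ cong (_% N) (sym (+-assoc g x w)) ⟩
    (g + x + w) % N       ≡⟨ reduce g+x≡z[+N] ⟩
    (z + w) % N           ∎
    where
    open ≡-Reasoning
    reduce : g + x ≡ z ⊎ g + x ≡ z + N → (g + x + w) % N ≡ (z + w) % N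
    reduce (inj₁ g+x≡z)   = cong (λ y → (y + w) % N) g+x≡z
    reduce (inj₂ g+x≡z+N) = begin
      (g + x + w) % N ≡⟨ cong (λ y → (y + w) % N) g+x≡z+N ⟩
      (z + N + w) % N ≡⟨ cong (_% N) (xy∙z≈xz∙y z N w) ⟩
      (z + w + N) % N ≡⟨ [m+n]%n≡m%n (z + w) N ⟩
      (z + w) % N     ∎

∈-remove⁻ : ∀ {v F x} → x ∈ remove v F → x ∈ F × x ≢ v
∈-remove⁻ {v} {F} = ∈-filter⁻ (λ x → ¬? (x ≟ v)) {xs = F}

∈-remove⁺ : ∀ {v F x} → x ∈ F → x ≢ v → x ∈ remove v F
∈-remove⁺ {v} = ∈-filter⁺ (λ x → ¬? (x ≟ v))

∈-link⁻ : ∀ {K v τ} → τ ∈ link K v → ∃ λ F → F ∈ K × v ∈ F × τ ≡ remove v F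
∈-link⁻ {K} {v} τ∈ with ∈-map⁻ (remove v) τ∈
... | F , F∈ , τ≡ with ∈-filter⁻ (v ∈?_) {xs = K} F∈
...   | F∈K , v∈F = F , F∈K , v∈F , τ≡

∈-link⁺ : ∀ {K v F} → F ∈ K → v ∈ F → remove v F ∈ link K v
∈-link⁺ {K} {v} F∈K v∈F = ∈-map⁺ (remove v) (∈-filter⁺ (v ∈?_) F∈K v∈F)

_⊑_ : Complex → Complex → Set
K ⊑ L = ∀ {τ} → τ ∈ K → ∃ λ τ′ → τ′ ∈ L × τ ⊆ τ′

⊑∧⊒⇒≈ : ∀ {K L} → K ⊑ L → L ⊑ K → K ≈ L
⊑∧⊒⇒≈ K⊑L L⊑K σ = faces K⊑L , faces L⊑K
  where
  faces : ∀ {K L} → K ⊑ L → IsFace K σ → IsFace L σ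
  faces K⊑L (τ , τ∈ , σ⊆τ) =
    let τ′ , τ′∈ , τ⊆τ′ = K⊑L τ∈ in τ′ , τ′∈ , λ x∈σ → τ⊆τ′ (σ⊆τ x∈σ)

translate : (N : ℕ) .{{_ : NonZero N}} → ℕ → List ℕ → List ℕ
translate N w = map (λ x → (x + w) % N)

module _ {d N} .{{_ : NonZero N}} (b : Fin (suc d) → ℕ) {w : ℕ} where

  ∈-translate⁻ : ∀ {x} → x ∈ translate N w (psums b) → ∃ λ s → x ≡ (prefixSum b s + w) % N
  ∈-translate⁻ = ∈-map-psums⁻ b (λ x → (x + w) % N)

  ∈-translate⁺ : ∀ s → (prefixSum b s + w) % N ∈ translate N w (psums b)
  ∈-translate⁺ = ∈-map-psums⁺ b (λ x → (x + w) % N)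

  ∈-remove-translate⁻ : ∀ {v x} → x ∈ remove v (translate N w (psums b)) →
                        ∃ λ s → x ≡ (prefixSum b s + w) % N × x ≢ v
  ∈-remove-translate⁻ x∈ = let x∈F , x≢v = ∈-remove⁻ x∈ ; s , x≡ = ∈-translate⁻ x∈F in s , x≡ , x≢v

  ∈-remove-translate⁺ : ∀ {v} s → (prefixSum b s + w) % N ≢ v →
                        (prefixSum b s + w) % N ∈ remove v (translate N w (psums b))
  ∈-remove-translate⁺ s = ∈-remove⁺ (∈-translate⁺ s)

translate-injective : ∀ {d N} .{{_ : NonZero N}} (b : Fin (suc d) → ℕ) → (∀ j → 0 < b j) → ΣF b ≡ N →
                      ∀ w {s t} → (prefixSum b s + w) % N ≡ (prefixSum b t + w) % N → s ≡ t
translate-injective b b>0 Σb w {s} {t} e = prefixSum-injective b b>0 (+-%-cancelʳ w (below s) (below t) e)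
  where
  below : ∀ s → prefixSum b s < _
  below s = subst (prefixSum b s <_) Σb (prefixSum<ΣF b b>0 s)

diffCycle≡ : ∀ {d N₀} (b : Fin (suc d) → ℕ) → ΣF b ≡ suc N₀ →
             diffCycle b ≡ map (λ w → translate (suc N₀) w (psums b)) (upTo (suc N₀))
diffCycle≡ b Σb = cong (λ N → map (λ w → map (λ x → modN (x + w) N) (psums b)) (upTo N)) Σb

module _ {m d N₀} (b : Fin m → Fin (suc d) → ℕ) (Σb : ∀ i → ΣF (b i) ≡ suc N₀) where

  ∈-diffCycles⁻ : ∀ {F} → F ∈ diffCycles b →
                  ∃ λ i → ∃ λ w → w < suc N₀ × F ≡ translate (suc N₀) w (psums (b i))
  ∈-diffCycles⁻ F∈ with find (∈-concatMap⁻ (λ i → diffCycle (b i)) {xs = allFin m} F∈)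
  ... | i , _ , F∈bᵢ with ∈-map⁻ _ (subst (_ ∈_) (diffCycle≡ (b i) (Σb i)) F∈bᵢ)
  ...   | w , w∈ , F≡ = i , w , ∈-upTo⁻ w∈ , F≡

  ∈-diffCycles⁺ : ∀ i {w} → w < suc N₀ → translate (suc N₀) w (psums (b i)) ∈ diffCycles b
  ∈-diffCycles⁺ i w<N = ∈-concatMap⁺ (λ i → diffCycle (b i)) (lose (∈-allFin i)
    (subst (translate (suc N₀) _ (psums (b i)) ∈_) (sym (diffCycle≡ (b i) (Σb i)))
      (∈-map⁺ (λ w → translate (suc N₀) w (psums (b i))) (∈-upTo⁺ w<N))))

  diffCycles-pure : (∀ i j → 0 < b i j) → Pure d (diffCycles b)
  diffCycles-pure b>0 τ τ∈ with ∈-diffCycles⁻ τ∈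
  ... | i , w , _ , refl =
    subst Unique (sym tab) (Unique.tabulate⁺ (translate-injective (b i) (b>0 i) (Σb i) w)) ,
    trans (cong length tab) (length-tabulate (λ s → (prefixSum (b i) s + w) % suc N₀))
    where tab = map-psums (b i) (λ x → (x + w) % suc N₀)

module Stretch (n₀ l k : ℕ) where

  n n′ : ℕ
  n = suc n₀
  n′ = suc (n₀ + l * k)

  stretch : ℕ → ℕ
  stretch y = y + y * suc l / n * k

  stretch<n′ : ∀ {y} → y < n → stretch y < n′
  stretch<n′ {y} y<n = +-mono-<-≤ y<n (*-monoˡ-≤ k (s≤s⁻¹ quotient<1+l))
    where
    quotient<1+l : y * suc l / n < suc l
    quotient<1+l = m<n*o⇒m/o<n (subst (y * suc l <_) (*-comm n (suc l)) (*-monoˡ-< (suc l) y<n))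

  stretch-strictMono : ∀ {y z} → y < z → stretch y < stretch z
  stretch-strictMono y<z = +-mono-<-≤ y<z (*-monoˡ-≤ k (/-monoˡ-≤ n (*-monoˡ-≤ (suc l) (<⇒≤ y<z))))

  -- Only arguments below n matter; the second branch just makes the map injective on all of ℕ.
  linkMap : ℕ → ℕ → ℕ
  linkMap v y with y <? n
  ... | yes _ = (stretch y + v) % n′
  ... | no  _ = y + n′

  linkMap-< : ∀ v {y} → y < n → linkMap v y ≡ (stretch y + v) % n′
  linkMap-< v {y} y<n with y <? n
  ... | yes _   = refl
  ... | no  y≮n = ⊥-elim (y≮n y<n)

  linkMap-injective : ∀ v → Injective _≡_ _≡_ (linkMap v)
  linkMap-injective v {y} {z} e with y <? n | z <? n
  ... | yes y<n | yes z<n = strictMono⇒injective <-cmp stretch stretch-strictMono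
                              (+-%-cancelʳ v (stretch<n′ y<n) (stretch<n′ z<n) e)
  ... | yes _   | no  _   = ⊥-elim (<-irrefl e (<-≤-trans (m%n<n (stretch y + v) n′) (m≤n+m n′ z)))
  ... | no  _   | yes _   = ⊥-elim (<-irrefl (sym e) (<-≤-trans (m%n<n (stretch z + v) n′) (m≤n+m n′ y)))
  ... | no  _   | no  _   = +-cancelʳ-≡ n′ y z e

  module Cycle {d} (a lj : Fin (suc d) → ℕ) (a>0 : ∀ j → 0 < a j) (Σa : ΣF a ≡ n) (Σlj : ΣF lj ≡ l)
               (lower : ∀ j → lj j * n < a j * (l + 1)) where

    aₖ : Fin (suc d) → ℕ
    aₖ j = a j + lj j * k

    -- The lower bounds say a j (l+1) = lj j · n + r j with r j > 0, and summing gives Σ r = n.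
    -- Hence R s < n is the remainder of A s (l+1) modulo n, and R is strictly increasing:
    -- this monotonicity decides the carries in quotient-step and quotient-wrap.
    r : Fin (suc d) → ℕ
    r j = a j * suc l ∸ lj j * n

    lower′ : ∀ j → lj j * n < a j * suc l
    lower′ j = subst (λ x → lj j * n < a j * x) (+-comm l 1) (lower j)

    a[1+l]≡lj*n+r : ∀ j → a j * suc l ≡ lj j * n + r j
    a[1+l]≡lj*n+r j = sym (m+[n∸m]≡n (<⇒≤ (lower′ j)))

    r>0 : ∀ j → 0 < r j
    r>0 j = m<n⇒0<n∸m (lower′ j)

    Σr≡n : ΣF r ≡ n
    Σr≡n = +-cancelˡ-≡ (l * n) _ _ (begin
      l * n + ΣF r                     ≡⟨ cong (_+ ΣF r) (trans (cong (_* n) (sym Σlj)) (sym (ΣF-* lj n))) ⟩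
      ΣF (λ j → lj j * n) + ΣF r       ≡⟨ sym (ΣF-+ (λ j → lj j * n) r) ⟩
      ΣF (λ j → lj j * n + r j)        ≡⟨ sym (ΣF-cong a[1+l]≡lj*n+r) ⟩
      ΣF (λ j → a j * suc l)           ≡⟨ ΣF-* a (suc l) ⟩
      ΣF a * suc l                     ≡⟨ cong (_* suc l) Σa ⟩
      n * suc l                        ≡⟨ ln+n≡n[1+l] ⟩
      l * n + n                        ∎)
      where
      open ≡-Reasoning
      ln+n≡n[1+l] : n * suc l ≡ l * n + n
      ln+n≡n[1+l] = trans (*-suc n l) (trans (+-comm n (n * l)) (cong (_+ n) (*-comm n l)))

    A Λ R Aₖ : Fin (suc d) → ℕ
    A  = prefixSum a
    Λ  = prefixSum lj
    R  = prefixSum r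
    Aₖ = prefixSum aₖ

    A[1+l]≡Λ*n+R : ∀ s → A s * suc l ≡ Λ s * n + R s
    A[1+l]≡Λ*n+R s = begin
      A s * suc l                            ≡⟨ sym (prefixSum-* a (suc l) s) ⟩
      prefixSum (λ j → a j * suc l) s        ≡⟨ prefixSum-cong a[1+l]≡lj*n+r s ⟩
      prefixSum (λ j → lj j * n + r j) s     ≡⟨ prefixSum-+ (λ j → lj j * n) r s ⟩
      prefixSum (λ j → lj j * n) s + R s     ≡⟨ cong (_+ R s) (prefixSum-* lj n s) ⟩
      Λ s * n + R s                          ∎
      where open ≡-Reasoning

    A<n : ∀ s → A s < n
    A<n s = subst (A s <_) Σa (prefixSum<ΣF a a>0 s)

    R<n : ∀ s → R s < n
    R<n s = subst (R s <_) Σr≡n (prefixSum<ΣF r r>0 s)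

    aₖ>0 : ∀ j → 0 < aₖ j
    aₖ>0 j = <-≤-trans (a>0 j) (m≤m+n _ _)

    Σaₖ≡n′ : ΣF aₖ ≡ n′
    Σaₖ≡n′ = trans (ΣF-+ a (λ j → lj j * k)) (cong₂ _+_ Σa (trans (ΣF-* lj k) (cong (_* k) Σlj)))

    Aₖ≡A+Λ*k : ∀ s → Aₖ s ≡ A s + Λ s * k
    Aₖ≡A+Λ*k s = trans (prefixSum-+ a (λ j → lj j * k) s) (cong (A s +_) (prefixSum-* lj k s))

    quotient-sum : ∀ y t → (y * suc l / n + Λ t) * n + (y * suc l % n + R t) ≡ (y + A t) * suc l
    quotient-sum y t = begin
      (q + Λ t) * n + (ρ + R t)     ≡⟨ rearrange q (Λ t) ρ (R t) ⟩
      (ρ + q * n) + (Λ t * n + R t) ≡⟨ cong₂ _+_ (sym (m≡m%n+[m/n]*n (y * suc l) n)) (sym (A[1+l]≡Λ*n+R t)) ⟩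
      y * suc l + A t * suc l       ≡⟨ sym (*-distribʳ-+ (suc l) y (A t)) ⟩
      (y + A t) * suc l             ∎
      where
      open ≡-Reasoning
      q = y * suc l / n
      ρ = y * suc l % n
      rearrange : ∀ q L ρ R → (q + L) * n + (ρ + R) ≡ (ρ + q * n) + (L * n + R)
      rearrange = solve-∀

    quotient-step : ∀ {s t} y → toℕ t < toℕ s → y + A t ≡ A s → y * suc l / n + Λ t ≡ Λ s
    quotient-step {s} {t} y t<s y+At≡As
      with carry-split (m%n<n (y * suc l) n) (R<n t) (R<n s)
             (trans (quotient-sum y t) (trans (cong (_* suc l) y+At≡As) (A[1+l]≡Λ*n+R s)))
    ... | inj₁ (q+Λt≡Λs , _) = q+Λt≡Λs
    ... | inj₂ (_ , Rs<Rt)   = ⊥-elim (<-asym Rs<Rt (prefixSum-strictMono r r>0 t<s))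

    quotient-wrap : ∀ {s t} y → toℕ s < toℕ t → y + A t ≡ A s + n → y * suc l / n + Λ t ≡ Λ s + l
    quotient-wrap {s} {t} y s<t y+At≡As+n
      with carry-split (m%n<n (y * suc l) n) (R<n t) (R<n s)
             (trans (quotient-sum y t) (trans (cong (_* suc l) y+At≡As+n) wrapped))
      where
      wrapped : (A s + n) * suc l ≡ (Λ s + suc l) * n + R s
      wrapped = begin
        (A s + n) * suc l          ≡⟨ *-distribʳ-+ (suc l) (A s) n ⟩
        A s * suc l + n * suc l    ≡⟨ cong (_+ n * suc l) (A[1+l]≡Λ*n+R s) ⟩
        Λ s * n + R s + n * suc l  ≡⟨ rearrange (Λ s) (R s) ⟩
        (Λ s + suc l) * n + R s    ∎
        where
        open ≡-Reasoning
        rearrange : ∀ L R → L * n + R + n * suc l ≡ (L + suc l) * n + R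
        rearrange = solve-∀
    ... | inj₁ (_ , Rt≤Rs)   = ⊥-elim (<⇒≱ (prefixSum-strictMono r r>0 s<t) Rt≤Rs)
    ... | inj₂ (1+q+Λt≡Λs+1+l , _) = suc-injective (trans 1+q+Λt≡Λs+1+l (+-suc (Λ s) l))

    stretch+Aₖ : ∀ y t → stretch y + Aₖ t ≡ (y + A t) + (y * suc l / n + Λ t) * k
    stretch+Aₖ y t = begin
      (y + q * k) + Aₖ t            ≡⟨ cong (y + q * k +_) (Aₖ≡A+Λ*k t) ⟩
      (y + q * k) + (A t + Λ t * k) ≡⟨ interchange y (q * k) (A t) (Λ t * k) ⟩
      (y + A t) + (q * k + Λ t * k) ≡⟨ cong ((y + A t) +_) (sym (*-distribʳ-+ k q (Λ t))) ⟩
      (y + A t) + (q + Λ t) * k     ∎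
      where
      open ≡-Reasoning
      q = y * suc l / n

    stretch-step : ∀ {s t} y → toℕ t < toℕ s → y + A t ≡ A s → stretch y + Aₖ t ≡ Aₖ s
    stretch-step {s} {t} y t<s y+At≡As = begin
      stretch y + Aₖ t                      ≡⟨ stretch+Aₖ y t ⟩
      (y + A t) + (y * suc l / n + Λ t) * k ≡⟨ cong₂ (λ x q → x + q * k) y+At≡As
                                                      (quotient-step y t<s y+At≡As) ⟩
      A s + Λ s * k                         ≡⟨ sym (Aₖ≡A+Λ*k s) ⟩
      Aₖ s                                  ∎
      where open ≡-Reasoning

    stretch-wrap : ∀ {s t} y → toℕ s < toℕ t → y + A t ≡ A s + n → stretch y + Aₖ t ≡ Aₖ s + n′
    stretch-wrap {s} {t} y s<t y+At≡As+n = begin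
      stretch y + Aₖ t                      ≡⟨ stretch+Aₖ y t ⟩
      (y + A t) + (y * suc l / n + Λ t) * k ≡⟨ cong₂ (λ x q → x + q * k) y+At≡As+n
                                                      (quotient-wrap y s<t y+At≡As+n) ⟩
      (A s + n) + (Λ s + l) * k             ≡⟨ cong (A s + n +_) (*-distribʳ-+ k (Λ s) l) ⟩
      (A s + n) + (Λ s * k + l * k)         ≡⟨ interchange (A s) n (Λ s * k) (l * k) ⟩
      (A s + Λ s * k) + (n + l * k)         ≡⟨ cong (_+ n′) (sym (Aₖ≡A+Λ*k s)) ⟩
      Aₖ s + n′                             ∎
      where open ≡-Reasoning

    stretch-difference : ∀ {s t w} → s ≢ t → (A t + w) % n ≡ 0 →
                         stretch ((A s + w) % n) + Aₖ t ≡ Aₖ s ⊎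
                         stretch ((A s + w) % n) + Aₖ t ≡ Aₖ s + n′
    stretch-difference {s} {t} {w} s≢t At+w≡0 with Fin.<-cmp s t | %-difference w (A<n s) (A<n t) At+w≡0
    ... | tri≈ _ s≡t _ | _         = ⊥-elim (s≢t s≡t)
    ... | tri< s<t _ _ | inj₂ wrap = inj₂ (stretch-wrap _ s<t wrap)
    ... | tri< s<t _ _ | inj₁ step =
      ⊥-elim (<⇒≱ (prefixSum-strictMono a a>0 s<t) (subst (A t ≤_) step (m≤n+m (A t) ((A s + w) % n))))
    ... | tri> _ _ t<s | inj₁ step = inj₁ (stretch-step _ t<s step)
    ... | tri> _ _ t<s | inj₂ wrap = ⊥-elim (<-irrefl wrap y+At<As+n)
      where
      y+At<As+n : (A s + w) % n + A t < A s + n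
      y+At<As+n = subst ((A s + w) % n + A t <_) (+-comm n (A s))
                    (+-mono-< (m%n<n (A s + w) n) (prefixSum-strictMono a a>0 t<s))

    linkMap-translate : ∀ {s t w₀ w v} → s ≢ t → (A t + w₀) % n ≡ 0 → (Aₖ t + w) % n′ ≡ v →
                        linkMap v ((A s + w₀) % n) ≡ (Aₖ s + w) % n′
    linkMap-translate {s} {t} {w₀} {w} {v} s≢t At+w₀≡0 Aₖt+w≡v = begin
      linkMap v y                        ≡⟨ linkMap-< v (m%n<n (A s + w₀) n) ⟩
      (stretch y + v) % n′               ≡⟨ cong (λ x → (stretch y + x) % n′) (sym Aₖt+w≡v) ⟩
      (stretch y + (Aₖ t + w) % n′) % n′ ≡⟨ %-shift {g = stretch y} w (stretch-difference s≢t At+w₀≡0) ⟩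
      (Aₖ s + w) % n′                    ∎
      where
      open ≡-Reasoning
      y = (A s + w₀) % n

module Links {d m n₀ l} (k : ℕ) (a lij : Fin m → Fin (suc d) → ℕ) (a>0 : ∀ i j → 0 < a i j)
             (Σa : ∀ i → ΣF (a i) ≡ suc n₀) (Σlij : ∀ i → ΣF (lij i) ≡ l)
             (lower : ∀ i j → lij i j * suc n₀ < a i j * (l + 1)) where

  open Stretch n₀ l k

  module C (i : Fin m) = Cycle (a i) (lij i) (a>0 i) (Σa i) (Σlij i) (lower i)

  aₖ : Fin m → Fin (suc d) → ℕ
  aₖ i j = a i j + lij i j * k

  N Nₖ : Complex
  N  = diffCycles a
  Nₖ = diffCycles aₖ

  link-Nₖ⊑ : ∀ v → link Nₖ v ⊑ map (map (linkMap v)) (link N 0)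
  link-Nₖ⊑ v τ∈ with ∈-link⁻ τ∈
  ... | F , F∈Nₖ , v∈F , refl with ∈-diffCycles⁻ aₖ C.Σaₖ≡n′ F∈Nₖ
  ... | i , w , _ , refl with ∈-translate⁻ (aₖ i) v∈F
  ... | t , v≡ = map (linkMap v) (remove 0 G) , ∈-map⁺ (map (linkMap v)) (∈-link⁺ G∈N 0∈G) , τ⊆
    where
    open C i using (A; linkMap-translate)
    w₀ = (n ∸ A t % n) % n
    At+w₀≡0 : (A t + w₀) % n ≡ 0
    At+w₀≡0 = [m+[o+[n∸m%n]]%n]%n≡o%n (A t) 0
    G = translate n w₀ (psums (a i))
    G∈N : G ∈ N
    G∈N = ∈-diffCycles⁺ a Σa i (m%n<n (n ∸ A t % n) n)
    0∈G : 0 ∈ G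
    0∈G = subst (_∈ G) At+w₀≡0 (∈-translate⁺ (a i) t)
    τ⊆ : remove v (translate n′ w (psums (aₖ i))) ⊆ map (linkMap v) (remove 0 G)
    τ⊆ x∈ with ∈-remove-translate⁻ (aₖ i) x∈
    ... | s , refl , x≢v = subst (_∈ map (linkMap v) (remove 0 G)) (linkMap-translate s≢t At+w₀≡0 (sym v≡))
                             (∈-map⁺ (linkMap v) (∈-remove-translate⁺ (a i) s y≢0))
      where
      s≢t : s ≢ t
      s≢t refl = x≢v (sym v≡)
      y≢0 : (A s + w₀) % n ≢ 0
      y≢0 y≡0 = s≢t (translate-injective (a i) (a>0 i) (Σa i) w₀ (trans y≡0 (sym At+w₀≡0)))

  link-Nₖ⊒ : ∀ {v} → v < n′ → map (map (linkMap v)) (link N 0) ⊑ link Nₖ v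
  link-Nₖ⊒ {v} v<n′ τ∈ with ∈-map⁻ (map (linkMap v)) τ∈
  ... | τ₀ , τ₀∈ , refl with ∈-link⁻ τ₀∈
  ... | G , G∈N , 0∈G , refl with ∈-diffCycles⁻ a Σa G∈N
  ... | i , w₀ , _ , refl with ∈-translate⁻ (a i) 0∈G
  ... | t , 0≡ = remove v F , ∈-link⁺ F∈Nₖ v∈F , τ⊆
    where
    open C i using (A; Aₖ; Σaₖ≡n′; aₖ>0; linkMap-translate)
    w = (v + (n′ ∸ Aₖ t % n′)) % n′
    Aₖt+w≡v : (Aₖ t + w) % n′ ≡ v
    Aₖt+w≡v = trans ([m+[o+[n∸m%n]]%n]%n≡o%n (Aₖ t) v) (m<n⇒m%n≡m v<n′)
    F = translate n′ w (psums (aₖ i))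
    F∈Nₖ : F ∈ Nₖ
    F∈Nₖ = ∈-diffCycles⁺ aₖ C.Σaₖ≡n′ i (m%n<n (v + (n′ ∸ Aₖ t % n′)) n′)
    v∈F : v ∈ F
    v∈F = subst (_∈ F) Aₖt+w≡v (∈-translate⁺ (aₖ i) t)
    τ⊆ : map (linkMap v) (remove 0 (translate n w₀ (psums (a i)))) ⊆ remove v F
    τ⊆ z∈ with ∈-map⁻ (linkMap v) z∈
    ... | y , y∈ , refl with ∈-remove-translate⁻ (a i) y∈
    ... | s , refl , y≢0 = subst (_∈ remove v F) (sym (linkMap-translate s≢t (sym 0≡) Aₖt+w≡v))
                             (∈-remove-translate⁺ (aₖ i) s x≢v)
      where
      s≢t : s ≢ t
      s≢t refl = y≢0 (sym 0≡)
      x≢v : (Aₖ s + w) % n′ ≢ v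
      x≢v x≡v = s≢t (translate-injective (aₖ i) aₖ>0 Σaₖ≡n′ w (trans x≡v (sym Aₖt+w≡v)))

  vertex<n′ : ∀ {v} → IsVertex Nₖ v → v < n′
  vertex<n′ (F , F∈Nₖ , v∈F) with ∈-diffCycles⁻ aₖ C.Σaₖ≡n′ F∈Nₖ
  ... | i , w , _ , refl with ∈-translate⁻ (aₖ i) v∈F
  ... | t , refl = m%n<n (prefixSum (aₖ i) t + w) n′

  0-isVertex : ∀ {v} → IsVertex Nₖ v → IsVertex N 0
  0-isVertex (F , F∈Nₖ , _) with ∈-diffCycles⁻ aₖ C.Σaₖ≡n′ F∈Nₖ
  ... | i , _ = translate n 0 (psums (a i)) , ∈-diffCycles⁺ a Σa i (s≤s z≤n) , ∈-translate⁺ (a i) zero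

  Nₖ-isCombManifold : IsCombManifold d N → IsCombManifold d Nₖ
  Nₖ-isCombManifold (_ , N-links) = diffCycles-pure aₖ C.Σaₖ≡n′ (C.aₖ>0) , λ v v∈Nₖ →
    inj₂ (inj₂ (inj₂ (linkMap v , linkMap-injective v ,
      ⊑∧⊒⇒≈ (link-Nₖ⊑ v) (link-Nₖ⊒ (vertex<n′ v∈Nₖ))))) ◅ N-links 0 (0-isVertex v∈Nₖ)

theorem3p7 : (d m n l : ℕ)
    → (a : Fin m → Fin (suc d) → ℕ)
    → (lij : Fin m → Fin (suc d) → ℕ)
    → (∀ i j → 0 < a i j)
    → (∀ i → ΣF (a i) ≡ n)
    → IsCombManifold d (diffCycles a)
    → (∀ i → ΣF (lij i) ≡ l)
    → (∀ i j → a i j * (l + 1) < (lij i j + 1) * n)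
    → (∀ i j → lij i j * n < a i j * (l + 1))
    → ∀ (k : ℕ) → IsCombManifold d (diffCycles (λ i j → a i j + lij i j * k))
theorem3p7 _ zero _ _ _ _ _ _ _ _ _ _ _ = (λ _ ()) , λ { _ (_ , () , _) }
-- The upper bounds are used only to rule out n = 0: otherwise R s < n already follows from Σ r = n.
theorem3p7 _ (suc _) zero l a lij _ _ _ _ upper _ _ =
  ⊥-elim (n≮0 (subst (a zero zero * (l + 1) <_) (*-zeroʳ (lij zero zero + 1)) (upper zero zero)))
theorem3p7 _ (suc _) (suc _) _ a lij a>0 Σa N-manifold Σlij _ lower k =
  Links.Nₖ-isCombManifold k a lij a>0 Σa Σlij lower N-manifold
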